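{- $\Diamond_1\Box_2(\Diamond_1 p\to\Box_1 p)\notin \mathsf{S4.1}\ast\mathsf{S4}$.
   Context: $\Diamond_i=\lnot\Box_i\lnot$. $\mathsf{S4}=\mathsf{K}+\Box p\to p+\Box p\to\Box\Box p$, $\mathsf{S4.1}=\mathsf{S4}+\Box\Diamond p\to\Diamond\Box p$. The fusion $\mathsf{S4.1}\ast\mathsf{S4}$ is the smallest normal bimodal logic (closed under substitution, modus ponens, and necessitation for $\Box_1,\Box_2$, containing tautologies and the K axioms for both boxes) containing the axioms of $\mathsf{S4.1}$ with $\Box$ replaced by $\Box_1$ and those of $\mathsf{S4}$ with $\Box$ replaced by $\Box_2$. -}

module Defs where

open import Data.Nat using (ℕ)
open import Data.Bool using (Bool; true; false; not; _∧_; _∨_)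
open import Relation.Binary.PropositionalEquality using (_≡_)

data Idx : Set where
  one two : Idx

data Fm : Set where
  var  : ℕ → Fm
  ⊥'   : Fm
  _⇒_  : Fm → Fm → Fm
  □    : Idx → Fm → Fm

infixr 5 _⇒_

¬' : Fm → Fm
¬' φ = φ ⇒ ⊥'

◇ : Idx → Fm → Fm
◇ i φ = ¬' (□ i (¬' φ))

subst : (ℕ → Fm) → Fm → Fm
subst σ (var n)  = σ n
subst σ ⊥'       = ⊥'
subst σ (φ ⇒ ψ)  = subst σ φ ⇒ subst σ ψ
subst σ (□ i φ)  = □ i (subst σ φ)

_⇒ᵇ_ : Bool → Bool → Bool
a ⇒ᵇ b = not a ∨ b

eval : (ℕ → Bool) → (Idx → Fm → Bool) → Fm → Bool
eval v b (var n)  = v n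
eval v b ⊥'       = false
eval v b (φ ⇒ ψ)  = eval v b φ ⇒ᵇ eval v b ψ
eval v b (□ i φ)  = b i φ

-- φ is a (substitution instance of a) propositional tautology.
Tautology : Fm → Set
Tautology φ = ∀ (v : ℕ → Bool) (b : Idx → Fm → Bool) → eval v b φ ≡ true

p : Fm
p = var 0

q : Fm
q = var 1

data S4·1∗S4 : Fm → Set where
  taut  : ∀ {φ} → Tautology φ → S4·1∗S4 φ
  axK   : ∀ i → S4·1∗S4 (□ i (p ⇒ q) ⇒ (□ i p ⇒ □ i q))
  axT₁  : S4·1∗S4 (□ one p ⇒ p)
  ax4₁  : S4·1∗S4 (□ one p ⇒ □ one (□ one p))
  axM₁  : S4·1∗S4 (□ one (◇ one p) ⇒ ◇ one (□ one p))
  axT₂  : S4·1∗S4 (□ two p ⇒ p)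
  ax4₂  : S4·1∗S4 (□ two p ⇒ □ two (□ two p))
  mp    : ∀ {φ ψ} → S4·1∗S4 (φ ⇒ ψ) → S4·1∗S4 φ → S4·1∗S4 ψ
  nec   : ∀ i {φ} → S4·1∗S4 φ → S4·1∗S4 (□ i φ)
  sub   : ∀ (σ : ℕ → Fm) {φ} → S4·1∗S4 φ → S4·1∗S4 (subst σ φ)

-- The formula is refuted in a three-point bimodal Kripke model. The □₁-relation is the fork
-- in which a root sees itself and two endpoints, each of which sees only itself; □₂ is the
-- universal relation. Both relations are preorders and every point □₁-sees an endpoint, so
-- the frame validates S4.1 ∗ S4. With p true only at one endpoint, ◇₁p → □₁p fails at the
-- root, hence □₂(◇₁p → □₁p) fails everywhere and ◇₁□₂(◇₁p → □₁p) fails at the root.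
module Submission where

open import Data.Bool using (Bool; true; false; T)
open import Data.Bool.ListAction using (and; all)
open import Data.Bool.Properties using (T-≡)
open import Data.List using (List; []; _∷_)
open import Data.List.Membership.Propositional using (_∈_)
open import Data.List.Properties using (map-cong)
open import Data.List.Relation.Unary.All as All using ()
open import Data.List.Relation.Unary.All.Properties using (all⁺; all⁻)
open import Data.List.Relation.Unary.Any using (here; there)
open import Data.Nat using (ℕ)
open import Data.Product using (Σ-syntax; _×_; _,_)
open import Function using (Equivalence)
open import Relation.Binary.PropositionalEquality as ≡ using (_≡_; refl; cong; cong₂)
open import Relation.Nullary using (¬_)
open import Relation.Nullary.Decidable using (T?; decidable-stable)

open import Defs

⇒ᵇ-intro : ∀ {a b} → (T a → T b) → T (a ⇒ᵇ b)
⇒ᵇ-intro {false} _ = _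
⇒ᵇ-intro {true}  f = f _

⇒ᵇ-elim : ∀ {a b} → T (a ⇒ᵇ b) → T a → T b
⇒ᵇ-elim {true} h _ = h

record FiniteFrame : Set₁ where
  field
    World    : Set
    worlds   : List World
    complete : ∀ w → w ∈ worlds
    R        : Idx → World → World → Bool

module KripkeSemantics (F : FiniteFrame) where
  open FiniteFrame F

  Valuation : Set
  Valuation = ℕ → World → Bool

  box : Idx → World → (World → Bool) → Bool
  box i w f = all (λ u → R i w u ⇒ᵇ f u) worlds

  sat : Valuation → World → Fm → Bool
  sat V w (var n) = V n w
  sat V w ⊥'      = false
  sat V w (φ ⇒ ψ) = sat V w φ ⇒ᵇ sat V w ψ
  sat V w (□ i φ) = box i w (λ u → sat V u φ)

  Holds : Valuation → World → Fm → Set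
  Holds V w φ = T (sat V w φ)

  Valid : Fm → Set
  Valid φ = ∀ V w → Holds V w φ

  box-intro : ∀ {i w f} → (∀ u → T (R i w u) → T (f u)) → T (box i w f)
  box-intro {i} {w} {f} h =
    all⁻ (λ u → R i w u ⇒ᵇ f u) {worlds} (All.tabulate λ {u} _ → ⇒ᵇ-intro (h u))

  box-elim : ∀ {i w f u} → T (box i w f) → T (R i w u) → T (f u)
  box-elim {i} {w} {f} {u} h = ⇒ᵇ-elim (All.lookup (all⁺ _ worlds h) (complete u))

  box-cong : ∀ i w {f g : World → Bool} → (∀ u → f u ≡ g u) → box i w f ≡ box i w g
  box-cong i w f≗g = cong and (map-cong (λ u → cong (R i w u ⇒ᵇ_) (f≗g u)) worlds)

  ◇-intro : ∀ {V i w u φ} → T (R i w u) → Holds V u φ → Holds V w (◇ i φ)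
  ◇-intro r h = ⇒ᵇ-intro λ □¬φ → ⇒ᵇ-elim (box-elim □¬φ r) h

  ◇-elim : ∀ {V i w φ} → Holds V w (◇ i φ) → ¬ (∀ u → T (R i w u) → ¬ Holds V u φ)
  ◇-elim h ¬φ = ⇒ᵇ-elim h (box-intro λ u r → ⇒ᵇ-intro (¬φ u r))

  eval-sat : ∀ V w φ → eval (λ n → V n w) (λ i ψ → sat V w (□ i ψ)) φ ≡ sat V w φ
  eval-sat V w (var n) = refl
  eval-sat V w ⊥'      = refl
  eval-sat V w (φ ⇒ ψ) = cong₂ _⇒ᵇ_ (eval-sat V w φ) (eval-sat V w ψ)
  eval-sat V w (□ i φ) = refl

  sat-subst : ∀ σ V w φ → sat V w (subst σ φ) ≡ sat (λ n u → sat V u (σ n)) w φ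
  sat-subst σ V w (var n) = refl
  sat-subst σ V w ⊥'      = refl
  sat-subst σ V w (φ ⇒ ψ) = cong₂ _⇒ᵇ_ (sat-subst σ V w φ) (sat-subst σ V w ψ)
  sat-subst σ V w (□ i φ) = box-cong i w (λ u → sat-subst σ V u φ)

  tautology-valid : ∀ {φ} → Tautology φ → Valid φ
  tautology-valid {φ} t V w =
    Equivalence.from T-≡ (≡.trans (≡.sym (eval-sat V w φ)) (t _ _))

  K-valid : ∀ i → Valid (□ i (p ⇒ q) ⇒ (□ i p ⇒ □ i q))
  K-valid i V w = ⇒ᵇ-intro λ □p⇒q → ⇒ᵇ-intro λ □p →
    box-intro λ u r → ⇒ᵇ-elim (box-elim □p⇒q r) (box-elim □p r)

  Reflexive : Idx → Set
  Reflexive i = ∀ w → T (R i w w)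

  Transitive : Idx → Set
  Transitive i = ∀ {w u v} → T (R i w u) → T (R i u v) → T (R i w v)

  Final : Idx → World → Set
  Final i e = ∀ u → T (R i e u) → u ≡ e

  SeesFinal : Idx → Set
  SeesFinal i = ∀ w → Σ[ e ∈ World ] T (R i w e) × Final i e

  T-valid : ∀ {i} → Reflexive i → Valid (□ i p ⇒ p)
  T-valid refl-R V w = ⇒ᵇ-intro λ □p → box-elim □p (refl-R w)

  4-valid : ∀ {i} → Transitive i → Valid (□ i p ⇒ □ i (□ i p))
  4-valid trans-R V w = ⇒ᵇ-intro λ □p →
    box-intro λ u r → box-intro λ v r′ → box-elim □p (trans-R r r′)

  -- At a final point e both ◇p and □p collapse to p, so □◇p at w yields p at e and then ◇□p at w.
  M-valid : ∀ {i} → SeesFinal i → Valid (□ i (◇ i p) ⇒ ◇ i (□ i p))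
  M-valid {i} sees-final V w = ⇒ᵇ-intro λ □◇p →
    let e , w⟶e , final = sees-final w

        p-at-e : T (V 0 e)
        p-at-e = decidable-stable (T? _) λ ¬p-at-e →
          ◇-elim {V} {i} {φ = p} (box-elim □◇p w⟶e) λ u e⟶u p-at-u →
            ¬p-at-e (≡.subst (λ x → T (V 0 x)) (final u e⟶u) p-at-u)

    in ◇-intro {V} {i} {φ = □ i p} w⟶e (box-intro λ u e⟶u →
         ≡.subst (λ x → T (V 0 x)) (≡.sym (final u e⟶u)) p-at-e)

  record S4·1∗S4-Frame : Set where
    field
      reflexive  : ∀ i → Reflexive i
      transitive : ∀ i → Transitive i
      sees-final : SeesFinal one

  module _ (frame : S4·1∗S4-Frame) where
    open S4·1∗S4-Frame frame

    S4·1∗S4-sound : ∀ {φ} → S4·1∗S4 φ → Valid φ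
    S4·1∗S4-sound (taut {φ} t)  = tautology-valid {φ} t
    S4·1∗S4-sound (axK i)       = K-valid i
    S4·1∗S4-sound axT₁          = T-valid (reflexive one)
    S4·1∗S4-sound ax4₁          = 4-valid (transitive one)
    S4·1∗S4-sound axM₁          = M-valid sees-final
    S4·1∗S4-sound axT₂          = T-valid (reflexive two)
    S4·1∗S4-sound ax4₂          = 4-valid (transitive two)
    S4·1∗S4-sound (mp d e) V w  = ⇒ᵇ-elim (S4·1∗S4-sound d V w) (S4·1∗S4-sound e V w)
    S4·1∗S4-sound (nec i d) V w = box-intro λ u _ → S4·1∗S4-sound d V u
    S4·1∗S4-sound (sub σ {φ} d) V w =
      ≡.subst T (≡.sym (sat-subst σ V w φ)) (S4·1∗S4-sound d _ w)

data ForkPoint : Set where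
  root left right : ForkPoint

forkR : Idx → ForkPoint → ForkPoint → Bool
forkR one root  _     = true
forkR one left  left  = true
forkR one right right = true
forkR one _     _     = false
forkR two _     _     = true

fork : FiniteFrame
fork = record
  { World    = ForkPoint
  ; worlds   = root ∷ left ∷ right ∷ []
  ; complete = λ { root → here refl ; left → there (here refl) ; right → there (there (here refl)) }
  ; R        = forkR
  }

open KripkeSemantics fork

fork-S4·1∗S4 : S4·1∗S4-Frame
fork-S4·1∗S4 = record
  { reflexive  = λ { one root → _ ; one left → _ ; one right → _ ; two _ → _ }
  ; transitive = transitive
  ; sees-final = λ { root → left , _ , final-left ; left → left , _ , final-left
                   ; right → right , _ , final-right }
  }
  where
  transitive : ∀ i → Transitive i
  transitive one {root}                _ _ = _
  transitive one {left}  {left}  {left}  _ _ = _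
  transitive one {right} {right} {right} _ _ = _
  transitive two                       _ _ = _

  final-left : Final one left
  final-left left _ = refl

  final-right : Final one right
  final-right right _ = refl

p-only-left : Valuation
p-only-left _ left = true
p-only-left _ _    = false

mainTheorem4 : ¬ S4·1∗S4 (◇ one (□ two (◇ one p ⇒ □ one p)))
mainTheorem4 d = S4·1∗S4-sound fork-S4·1∗S4 d p-only-left root
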